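{- Let $m\ge1$ and $n\ge1$ be integers. Define $F^{(m)}_j$ for $j\ge0$ by $F^{(m)}_0=\dots=F^{(m)}_m=1$ and $F^{(m)}_j=F^{(m)}_{j-1}+F^{(m)}_{j-m-1}$ for $j\ge m+1$. Then $$\sum_{k=1}^{\lfloor\frac{n}{m+1}\rfloor}\frac1k\sum_{d\mid\gcd(n,k)}\varphi(d)\binom{\frac{n-mk}{d}-1}{\frac kd-1}=\frac1n\sum_{\substack{d\mid n\\ d\le\lfloor\frac n{m+1}\rfloor}}\varphi(d)\left((m+1)F^{(m)}_{n/d}-m\,F^{(m)}_{n/d-1}-1\right),$$ where $\varphi$ is Euler's totient function.
   Context: Binomial convention: $\binom{a}{b}=0$ whenever $b>a$. -}

module Defs where

open import Data.Nat using (ℕ; zero; suc; _*_; _∸_; _≤?_)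
import Data.Nat
import Data.Nat as ℕ
open import Data.Nat.GCD using (gcd)
open import Data.Nat.Divisibility using (_∣?_)
open import Data.List using (List; []; _∷_; map; upTo; filter; length; foldr)
open import Data.Integer using (ℤ)
open import Data.Rational using (ℚ; 0ℚ; _+_; _/_)
open import Relation.Nullary using (yes; no)

-- F^{(m)}_j : F_0 = … = F_m = 1, F_j = F_{j-1} + F_{j-m-1} for j ≥ m+1.
-- Implemented with a fuel argument (fuel j+1 always suffices, since
-- every recursive call decreases the index by at least one).
Faux : ℕ → ℕ → ℕ → ℕ
Faux m zero    j = 0
Faux m (suc f) j with j ≤? m
... | yes _ = 1
... | no  _ = Faux m f (j ∸ 1) Data.Nat.+ Faux m f (j ∸ suc m)

F : ℕ → ℕ → ℕ
F m j = Faux m (suc j) j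

range1 : ℕ → List ℕ
range1 n = map suc (upTo n)

divisors : ℕ → List ℕ
divisors n = filter (λ d → d ∣? n) (range1 n)

φ : ℕ → ℕ
φ n = length (filter (λ k → gcd k n ℕ.≟ 1) (range1 n))

-- natural-number quotient, with the (never used) convention a ÷ 0 = 0
_div_ : ℕ → ℕ → ℕ
a div zero  = 0
a div suc d = a ℕ./ suc d

-- the rational number a / b, with the (never used) convention a / 0 = 0
frac : ℤ → ℕ → ℚ
frac a zero    = 0ℚ
frac a (suc b) = a / suc b

Σℚ : {A : Set} → List A → (A → ℚ) → ℚ
Σℚ xs f = foldr (λ x acc → f x + acc) 0ℚ xs

Σℤ : {A : Set} → List A → (A → ℤ) → ℤ
Σℤ xs f = foldr (λ x acc → f x Data.Integer.+ acc) (Data.Integer.+ 0) xs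

Σℕ : {A : Set} → List A → (A → ℕ) → ℕ
Σℕ xs f = foldr (λ x acc → f x Data.Nat.+ acc) 0 xs

-- The m-bonacci numbers are diagonal sums of Pascal's triangle, F_N = Σ_{j ≥ 0} C(N − mj, j): Pascal's
-- rule turns the right-hand side into a sum satisfying the defining recurrence of F_N. By absorption,
-- (N / j) C(N − mj − 1, j − 1) = C(N − mj, j) + m C(N − mj − 1, j − 1), and summing over
-- 1 ≤ j ≤ N / (m + 1) gives (m + 1) F_N − m F_{N−1} − 1. On the left-hand side exchange the sums over
-- k and d and write k = jd: for d ∣ n and N = n / d the inner sum is φ(d)/n times that sum, and
-- its range j ≤ ⌊n / (m + 1)⌋ / d is empty exactly when d > ⌊n / (m + 1)⌋.
module Submission where

open import Defs
open import Algebra.Bundles using (CommutativeMonoid)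
open import Data.Bool using (if_then_else_; true; false)
open import Data.Integer as ℤ using (ℤ; +_; _-_)
import Data.Integer.Properties as ℤP
import Data.Integer.Tactic.RingSolver as ℤ-Solver
open import Data.List using (List; []; _∷_; [_]; _++_; map; upTo; filter)
open import Data.List.Properties using (foldr-fusion; foldr-cong; map-++; upTo-∷ʳ)
open import Data.Nat as ℕ
  using (ℕ; zero; suc; _+_; _*_; _∸_; _≤_; _<_; _≤?_; z≤n; s≤s; z<s; NonZero)
open import Data.Nat.Combinatorics using (_C_; nCk+nC[k+1]≡[n+1]C[k+1]; nC1≡n)
open import Data.Nat.DivMod
  using (_/_; _%_; m≡m%n+[m/n]*n; m%n<n; m/n*n≤m; m/n≢0⇒n≤m; m<n⇒m/n≡0; m*n/n≡m; m/n*n≡m;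
         [m∸n*o]/o≡m/o∸n; m/n/o≡m/[n*o]; m*n/o*n≡m/o)
open import Data.Nat.Divisibility using (_∣_; _∣?_; ∣⇒≤; ∣m+n∣m⇒∣n; n∣m*n; ∣-trans)
open import Data.Nat.GCD using (gcd; gcd[m,n]∣m; gcd[m,n]∣n; gcd-greatest; gcd[m,n]≢0)
open import Data.Nat.Induction using (<-rec)
open import Data.Nat.Properties
import Data.Nat.Tactic.RingSolver as ℕ-Solver
open import Data.Rational as ℚ using (ℚ; 0ℚ; fromℚᵘ)
import Data.Rational.Properties as ℚP
open import Data.Rational.Unnormalised as ℚᵘ using (mkℚᵘ; *≡*)
import Data.Rational.Unnormalised.Properties as ℚᵘP
open import Data.Sum using (inj₁)
open import Function using (_∘_; mk⇔)
open import Level using (0ℓ)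
open import Relation.Binary.PropositionalEquality
  using (_≡_; refl; sym; trans; cong; cong₂; subst; module ≡-Reasoning)
open import Relation.Nullary using (yes; no; ¬_; Dec; does)
open import Relation.Nullary.Decidable using (dec-true; dec-false; does-⇔)
open import Relation.Nullary.Negation using (contradiction)
open import Relation.Unary using (Pred; Decidable)

if-yes : ∀ {p} {P : Set p} {A : Set} (P? : Dec P) {x y : A} → P → (if does P? then x else y) ≡ x
if-yes P? {x} {y} p = cong (if_then x else y) (dec-true P? p)

if-no : ∀ {p} {P : Set p} {A : Set} (P? : Dec P) {x y : A} → ¬ P → (if does P? then x else y) ≡ y
if-no P? {x} {y} ¬p = cong (if_then x else y) (dec-false P? ¬p)

nC[k+1]≡[n∸1]C[k+1]+[n∸1]Ck : ∀ n k → 0 < n + k → n C suc k ≡ (n ∸ 1) C suc k + (n ∸ 1) C k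
nC[k+1]≡[n∸1]C[k+1]+[n∸1]Ck (suc n) k _ = sym (trans (+-comm (n C suc k) (n C k)) (nCk+nC[k+1]≡[n+1]C[k+1] n k))
nC[k+1]≡[n∸1]C[k+1]+[n∸1]Ck zero (suc k) _ = refl

[k+1]*nC[k+1]≡n*[n∸1]Ck : ∀ k n → suc k * (n C suc k) ≡ n * ((n ∸ 1) C k)
[k+1]*nC[k+1]≡n*[n∸1]Ck zero n = trans (+-identityʳ (n C 1)) (trans (nC1≡n n) (sym (*-identityʳ n)))
[k+1]*nC[k+1]≡n*[n∸1]Ck (suc k) zero = *-zeroʳ (suc (suc k))
[k+1]*nC[k+1]≡n*[n∸1]Ck (suc k) (suc n) = begin
  suc (suc k) * (suc n C suc (suc k))
    ≡⟨ cong (suc (suc k) *_) (sym (nCk+nC[k+1]≡[n+1]C[k+1] n (suc k))) ⟩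
  suc (suc k) * (n C suc k + n C suc (suc k))
    ≡⟨ *-distribˡ-+ (suc (suc k)) (n C suc k) (n C suc (suc k)) ⟩
  (n C suc k + suc k * (n C suc k)) + suc (suc k) * (n C suc (suc k))
    ≡⟨ cong₂ (λ u v → (n C suc k + u) + v) ([k+1]*nC[k+1]≡n*[n∸1]Ck k n) ([k+1]*nC[k+1]≡n*[n∸1]Ck (suc k) n) ⟩
  (n C suc k + n * ((n ∸ 1) C k)) + n * ((n ∸ 1) C suc k)
    ≡⟨ trans (+-assoc (n C suc k) _ _) (cong (_+_ (n C suc k)) (sym (*-distribˡ-+ n _ _))) ⟩
  n C suc k + n * ((n ∸ 1) C k + (n ∸ 1) C suc k)
    ≡⟨ cong (_+_ (n C suc k)) (n*pascal n) ⟩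
  suc n * (n C suc k)
    ∎
  where
  open ≡-Reasoning
  n*pascal : ∀ n → n * ((n ∸ 1) C k + (n ∸ 1) C suc k) ≡ n * (n C suc k)
  n*pascal zero    = refl
  n*pascal (suc n) = cong (suc n *_) (nCk+nC[k+1]≡[n+1]C[k+1] n k)

rangeSum : {A : Set} → (A → A → A) → A → ℕ → (ℕ → A) → A
rangeSum _∙_ ε zero    f = ε
rangeSum _∙_ ε (suc n) f = rangeSum _∙_ ε n f ∙ f (suc n)

rangeSum-hom : ∀ {A B : Set} {_∙_ : A → A → A} {ε : A} {_◦_ : B → B → B} {ε′ : B}
  (h : A → B) → h ε ≡ ε′ → (∀ x y → h (x ∙ y) ≡ h x ◦ h y) →
  ∀ n f → h (rangeSum _∙_ ε n f) ≡ rangeSum _◦_ ε′ n (h ∘ f)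
rangeSum-hom h h-ε h-∙ zero    f = h-ε
rangeSum-hom {_◦_ = _◦_} h h-ε h-∙ (suc n) f =
  trans (h-∙ _ (f (suc n))) (cong (_◦ h (f (suc n))) (rangeSum-hom h h-ε h-∙ n f))

module RangeSum (M : CommutativeMonoid 0ℓ 0ℓ) where

  open CommutativeMonoid M
    renaming (refl to ≈-refl; sym to ≈-sym; trans to ≈-trans; reflexive to ≈-reflexive)
  open import Algebra.Properties.CommutativeSemigroup commutativeSemigroup using (interchange)
  open import Relation.Binary.Reasoning.Setoid setoid

  ∑ : ℕ → (ℕ → Carrier) → Carrier
  ∑ = rangeSum _∙_ ε

  ∑-cong : ∀ n {f g} → (∀ i → 1 ≤ i → i ≤ n → f i ≈ g i) → ∑ n f ≈ ∑ n g
  ∑-cong zero    f≈g = ≈-refl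
  ∑-cong (suc n) f≈g =
    ∙-cong (∑-cong n (λ i 1≤i i≤n → f≈g i 1≤i (m≤n⇒m≤1+n i≤n))) (f≈g (suc n) (s≤s z≤n) ≤-refl)

  ∑-ε : ∀ n {f} → (∀ i → 1 ≤ i → i ≤ n → f i ≈ ε) → ∑ n f ≈ ε
  ∑-ε n {f} f≈ε = ≈-trans (∑-cong n f≈ε) (∑-const n)
    where
    ∑-const : ∀ n → ∑ n (λ _ → ε) ≈ ε
    ∑-const zero    = ≈-refl
    ∑-const (suc n) = ≈-trans (identityʳ _) (∑-const n)

  ∑-distrib : ∀ n f g → ∑ n (λ i → f i ∙ g i) ≈ ∑ n f ∙ ∑ n g
  ∑-distrib zero    f g = ≈-sym (identityˡ ε)
  ∑-distrib (suc n) f g = ≈-trans (∙-congʳ (∑-distrib n f g)) (interchange _ _ _ _)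

  ∑-swap : ∀ a b (f : ℕ → ℕ → Carrier) → ∑ a (λ i → ∑ b (f i)) ≈ ∑ b (λ j → ∑ a (λ i → f i j))
  ∑-swap zero    b f = ≈-sym (∑-ε b (λ _ _ _ → ≈-refl))
  ∑-swap (suc a) b f = ≈-trans (∙-congʳ (∑-swap a b f)) (≈-sym (∑-distrib b (λ j → ∑ a (λ i → f i j)) (f (suc a))))

  ∑-suc : ∀ n f → ∑ (suc n) f ≈ f 1 ∙ ∑ n (f ∘ suc)
  ∑-suc zero    f = ≈-trans (identityˡ (f 1)) (≈-sym (identityʳ (f 1)))
  ∑-suc (suc n) f = ≈-trans (∙-congʳ (∑-suc n f)) (assoc _ _ _)

  ∑-pad : ∀ a t f → (∀ i → a < i → f i ≈ ε) → ∑ (t + a) f ≈ ∑ a f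
  ∑-pad a zero    f f≈ε = ≈-refl
  ∑-pad a (suc t) f f≈ε =
    ≈-trans (∙-cong (∑-pad a t f f≈ε) (f≈ε (suc (t + a)) (s≤s (m≤n+m a t)))) (identityʳ _)

  module _ (d′ : ℕ) (u : ℕ → Carrier) where

    private
      d : ℕ
      d = suc d′

      u∣ : ℕ → Carrier
      u∣ k = if does (d ∣? k) then u k else ε

      ∑-remainder : ∀ J r → r < d → ∑ (r + J * d) u∣ ≈ ∑ (J * d) u∣
      ∑-remainder J zero    _   = ≈-refl
      ∑-remainder J (suc r) r<d = ≈-trans
        (∙-cong (∑-remainder J r (<-trans (n<1+n r) r<d)) (≈-reflexive (if-no (d ∣? _) d∤)))
        (identityʳ _)
        where
        d∤ : ¬ (d ∣ suc r + J * d)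
        d∤ d∣ = <⇒≱ r<d (∣⇒≤ (∣m+n∣m⇒∣n (subst (d ∣_) (+-comm (suc r) (J * d)) d∣) (n∣m*n J)))

      ∑-whole : ∀ J → ∑ (J * d) u∣ ≈ ∑ J (λ j → u (j * d))
      ∑-whole zero    = ≈-refl
      ∑-whole (suc J) = ∙-cong
        (≈-trans (∑-remainder J d′ ≤-refl) (∑-whole J))
        (≈-reflexive (if-yes (d ∣? suc J * d) (n∣m*n (suc J))))

    ∑-multiples : ∀ K → ∑ K (λ k → if does (suc d′ ∣? k) then u k else ε)
                        ≈ ∑ (K / suc d′) (λ j → u (j * suc d′))
    ∑-multiples K = begin
      ∑ K u∣                          ≡⟨ cong (λ t → ∑ t u∣) (m≡m%n+[m/n]*n K d) ⟩
      ∑ (K % d + (K / d) * d) u∣      ≈⟨ ∑-remainder (K / d) (K % d) (m%n<n K d) ⟩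
      ∑ ((K / d) * d) u∣              ≈⟨ ∑-whole (K / d) ⟩
      ∑ (K / d) (λ j → u (j * d))     ∎

module ℕ∑ = RangeSum +-0-commutativeMonoid

[m∸1]∸n≡[m∸n]∸1 : ∀ m n → m ∸ 1 ∸ n ≡ m ∸ n ∸ 1
[m∸1]∸n≡[m∸n]∸1 m n = trans (∸-+-assoc m 1 n) (trans (cong (m ∸_) (+-comm 1 n)) (sym (∸-+-assoc m n 1)))

m<[1+m/n]*n : ∀ m n .{{_ : NonZero n}} → m < suc (m / n) * n
m<[1+m/n]*n m n = begin-strict
  m                     ≡⟨ m≡m%n+[m/n]*n m n ⟩
  m % n + (m / n) * n   <⟨ +-monoˡ-< ((m / n) * n) (m%n<n m n) ⟩
  suc (m / n) * n       ∎
  where open ≤-Reasoning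

∑-*ˡ : ∀ c n f → ℕ∑.∑ n (λ i → c * f i) ≡ c * ℕ∑.∑ n f
∑-*ˡ c n f = sym (rangeSum-hom (c *_) (*-zeroʳ c) (*-distribˡ-+ c) n f)

module MBonacci (m : ℕ) where

  open ℕ∑ using (∑; ∑-cong; ∑-ε; ∑-distrib; ∑-suc)

  diagonal : ℕ → ℕ → ℕ
  diagonal x j = (x ∸ m * j) C j

  shiftedDiagonal : ℕ → ℕ → ℕ
  shiftedDiagonal x j = (x ∸ m * j ∸ 1) C (j ∸ 1)

  -- (N / j) * shiftedDiagonal N j, written without division (see diagonal-absorption)
  lucasTerm : ℕ → ℕ → ℕ
  lucasTerm N j = diagonal N j + m * shiftedDiagonal N j

  diagonalSum : ℕ → ℕ → ℕ
  diagonalSum x B = 1 + ∑ B (diagonal x)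

  Faux-fuel : ∀ a b j → j < a → j < b → Faux m a j ≡ Faux m b j
  Faux-fuel (suc a) (suc b) j (s≤s j<a) (s≤s j<b) with j ≤? m
  ... | yes _ = refl
  Faux-fuel (suc a) (suc b) zero    _         _         | no j≰m = contradiction z≤n j≰m
  Faux-fuel (suc a) (suc b) (suc j) (s≤s j<a) (s≤s j<b) | no _   = cong₂ _+_
    (Faux-fuel a b j j<a j<b)
    (Faux-fuel a b (j ∸ m) (≤-<-trans (m∸n≤m j m) j<a) (≤-<-trans (m∸n≤m j m) j<b))

  F-≤ : ∀ {x} → x ≤ m → F m x ≡ 1
  F-≤ {x} x≤m with x ≤? m
  ... | yes _   = refl
  ... | no x≰m = contradiction x≤m x≰m

  F-rec : ∀ {x} → m < x → F m x ≡ F m (x ∸ 1) + F m (x ∸ suc m)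
  F-rec {suc x} m<x with suc x ≤? m
  ... | yes x<m = contradiction m<x (≤⇒≯ x<m)
  ... | no _    = cong (_+_ (F m x)) (Faux-fuel (suc x) (suc (x ∸ m)) (x ∸ m) (s≤s (m∸n≤m x m)) ≤-refl)

  diagonalSum-≤ : ∀ {x} → x ≤ m → ∀ B → diagonalSum x B ≡ 1
  diagonalSum-≤ {x} x≤m B = cong (_+_ 1) (∑-ε B vanish)
    where
    vanish : ∀ j → 1 ≤ j → j ≤ B → diagonal x j ≡ 0
    vanish (suc j) _ _ = cong (_C suc j) (n≤0⇒n≡0 (begin
      x ∸ m * suc j  ≤⟨ ∸-monoʳ-≤ x (m≤m*n m (suc j)) ⟩
      x ∸ m          ≡⟨ m≤n⇒m∸n≡0 x≤m ⟩
      0              ∎))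
      where open ≤-Reasoning

  diagonal-pascal : ∀ x j → m < x →
    diagonal x (suc j) ≡ diagonal (x ∸ 1) (suc j) + shiftedDiagonal x (suc j)
  diagonal-pascal x j m<x = begin
    y C suc j
      ≡⟨ nC[k+1]≡[n∸1]C[k+1]+[n∸1]Ck y j (0<y+j j) ⟩
    (y ∸ 1) C suc j + (y ∸ 1) C j
      ≡⟨ cong (λ z → z C suc j + (y ∸ 1) C j) (sym ([m∸1]∸n≡[m∸n]∸1 x (m * suc j))) ⟩
    diagonal (x ∸ 1) (suc j) + (y ∸ 1) C j ∎
    where
    open ≡-Reasoning
    y = x ∸ m * suc j
    0<y+j : ∀ i → 0 < x ∸ m * suc i + i
    0<y+j zero    = subst (0 <_) (sym (trans (+-identityʳ _) (cong (x ∸_) (*-identityʳ m)))) (m<n⇒0<n∸m m<x)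
    0<y+j (suc i) = <-≤-trans z<s (m≤n+m (suc i) _)

  diagonalSum-pascal : ∀ x B → (1 ≤ B → m < x) →
    diagonalSum x B ≡ diagonalSum (x ∸ 1) B + ∑ B (shiftedDiagonal x)
  diagonalSum-pascal x B 1≤B⇒m<x = begin
    1 + ∑ B (diagonal x)                                      ≡⟨ cong (_+_ 1) (∑-cong B termwise) ⟩
    1 + ∑ B (λ j → diagonal (x ∸ 1) j + shiftedDiagonal x j)  ≡⟨ cong (_+_ 1) (∑-distrib B _ _) ⟩
    1 + (∑ B (diagonal (x ∸ 1)) + ∑ B (shiftedDiagonal x))    ≡⟨ sym (+-assoc 1 _ (∑ B (shiftedDiagonal x))) ⟩
    diagonalSum (x ∸ 1) B + ∑ B (shiftedDiagonal x)           ∎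
    where
    open ≡-Reasoning
    termwise : ∀ j → 1 ≤ j → j ≤ B → diagonal x j ≡ diagonal (x ∸ 1) j + shiftedDiagonal x j
    termwise (suc j) _ j<B = diagonal-pascal x j (1≤B⇒m<x (≤-trans (s≤s z≤n) j<B))

  diagonalSum-rec : ∀ {x} B → m < x →
    diagonalSum x (suc B) ≡ diagonalSum (x ∸ 1) (suc B) + diagonalSum (x ∸ suc m) B
  diagonalSum-rec {x} B m<x = trans (diagonalSum-pascal x (suc B) (λ _ → m<x))
    (cong (_+_ (diagonalSum (x ∸ 1) (suc B))) (trans (∑-suc B _) (cong (_+_ 1) (∑-cong B reindex))))
    where
    reindex : ∀ i → 1 ≤ i → i ≤ B → (x ∸ m * suc i ∸ 1) C i ≡ diagonal (x ∸ suc m) i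
    reindex i _ _ = cong (_C i) (begin
      x ∸ m * suc i ∸ 1     ≡⟨ ∸-+-assoc x (m * suc i) 1 ⟩
      x ∸ (m * suc i + 1)   ≡⟨ cong (x ∸_) (trans (cong (_+ 1) (*-suc m i)) (+-comm (m + m * i) 1)) ⟩
      x ∸ (suc m + m * i)   ≡⟨ sym (∸-+-assoc x (suc m) (m * i)) ⟩
      x ∸ suc m ∸ m * i     ∎)
      where open ≡-Reasoning

  -- Terms with j > x / (m + 1) vanish, so any B with x < (m + 1)(B + 1) gives the whole diagonal sum.
  F≡diagonalSum : ∀ x B → x < suc m * suc B → F m x ≡ diagonalSum x B
  F≡diagonalSum = <-rec _ (λ x rec → step x rec (x ≤? m))
    where
    step : ∀ x → (∀ {y} → y < x → ∀ B → y < suc m * suc B → F m y ≡ diagonalSum y B) → Dec (x ≤ m) →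
           ∀ B → x < suc m * suc B → F m x ≡ diagonalSum x B
    step x rec (yes x≤m) B       _     = trans (F-≤ x≤m) (sym (diagonalSum-≤ x≤m B))
    step x rec (no x≰m)  zero    x<m+1 = contradiction (≤-pred (subst (x <_) (*-identityʳ (suc m)) x<m+1)) x≰m
    step x rec (no x≰m)  (suc B) x<bound = begin
      F m x
        ≡⟨ F-rec m<x ⟩
      F m (x ∸ 1) + F m (x ∸ suc m)
        ≡⟨ cong₂ _+_ (rec x∸1<x (suc B) x∸1<bound) (rec x∸m+1<x B x∸m+1<bound) ⟩
      diagonalSum (x ∸ 1) (suc B) + diagonalSum (x ∸ suc m) B
        ≡⟨ sym (diagonalSum-rec B m<x) ⟩
      diagonalSum x (suc B) ∎
      where
      open ≡-Reasoning
      m<x : m < x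
      m<x = ≰⇒> x≰m
      x∸1<x : x ∸ 1 < x
      x∸1<x = ∸-monoʳ-< z<s (≤-trans (s≤s z≤n) m<x)
      x∸m+1<x : x ∸ suc m < x
      x∸m+1<x = ∸-monoʳ-< z<s m<x
      x∸1<bound : x ∸ 1 < suc m * suc (suc B)
      x∸1<bound = ≤-<-trans (m∸n≤m x 1) x<bound
      x∸m+1<bound : x ∸ suc m < suc m * suc B
      x∸m+1<bound = m<n+o⇒m∸n<o x (suc m) (subst (x <_) (*-suc (suc m) (suc B)) x<bound)

  diagonal-absorption : ∀ N j → m * suc j ≤ N →
    N * shiftedDiagonal N (suc j) ≡ suc j * lucasTerm N (suc j)
  diagonal-absorption N j mj≤N = begin
    N * c
      ≡⟨ cong (_* c) (sym (m∸n+n≡m mj≤N)) ⟩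
    (N ∸ m * suc j + m * suc j) * c
      ≡⟨ *-distribʳ-+ c (N ∸ m * suc j) (m * suc j) ⟩
    (N ∸ m * suc j) * c + m * suc j * c
      ≡⟨ cong₂ _+_ (sym ([k+1]*nC[k+1]≡n*[n∸1]Ck j (N ∸ m * suc j))) (reorder m (suc j) c) ⟩
    suc j * diagonal N (suc j) + suc j * (m * c)
      ≡⟨ sym (*-distribˡ-+ (suc j) _ (m * c)) ⟩
    suc j * (diagonal N (suc j) + m * c) ∎
    where
    open ≡-Reasoning
    c = shiftedDiagonal N (suc j)
    reorder : ∀ a b c → a * b * c ≡ b * (a * c)
    reorder = ℕ-Solver.solve-∀

  mbonacci-identity : ∀ N →
    ∑ (N / suc m) (lucasTerm N) + 1 + m * F m (N ∸ 1) ≡ suc m * F m N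
  mbonacci-identity N = begin
    ∑ J (lucasTerm N) + 1 + m * F m (N ∸ 1)
      ≡⟨ cong₂ (λ s f → s + 1 + m * f)
           (trans (∑-distrib J _ _) (cong (_+_ (∑ J (diagonal N))) (∑-*ˡ m J (shiftedDiagonal N))))
           (F≡diagonalSum (N ∸ 1) J (≤-<-trans (m∸n≤m N 1) N<bound)) ⟩
    ∑ J (diagonal N) + m * ∑ J (shiftedDiagonal N) + 1 + m * diagonalSum (N ∸ 1) J
      ≡⟨ rearrange m (∑ J (diagonal N)) (∑ J (shiftedDiagonal N)) (diagonalSum (N ∸ 1) J) ⟩
    diagonalSum N J + m * (diagonalSum (N ∸ 1) J + ∑ J (shiftedDiagonal N))
      ≡⟨ cong (λ s → diagonalSum N J + m * s) (sym (diagonalSum-pascal N J m<N)) ⟩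
    suc m * diagonalSum N J
      ≡⟨ cong (suc m *_) (sym (F≡diagonalSum N J N<bound)) ⟩
    suc m * F m N
      ∎
    where
    open ≡-Reasoning
    J = N / suc m
    N<bound : N < suc m * suc J
    N<bound = subst (N <_) (*-comm (suc J) (suc m)) (m<[1+m/n]*n N (suc m))
    m<N : 1 ≤ J → m < N
    m<N 1≤J = m/n≢0⇒n≤m (λ J≡0 → contradiction (subst (1 ≤_) J≡0 1≤J) λ ())
    rearrange : ∀ m a c s → a + m * c + 1 + m * s ≡ (1 + a) + m * (s + c)
    rearrange = ℕ-Solver.solve-∀

module ℚ∑ = RangeSum ℚP.+-0-commutativeMonoid

fromℚᵘ-homo-+ : ∀ p q → fromℚᵘ (p ℚᵘ.+ q) ≡ fromℚᵘ p ℚ.+ fromℚᵘ q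
fromℚᵘ-homo-+ p q = ℚP.toℚᵘ-injective (begin
  ℚ.toℚᵘ (fromℚᵘ (p ℚᵘ.+ q))
    ≈⟨ ℚP.toℚᵘ-fromℚᵘ (p ℚᵘ.+ q) ⟩
  p ℚᵘ.+ q
    ≈⟨ ℚᵘP.+-cong (ℚᵘP.≃-sym (ℚP.toℚᵘ-fromℚᵘ p)) (ℚᵘP.≃-sym (ℚP.toℚᵘ-fromℚᵘ q)) ⟩
  ℚ.toℚᵘ (fromℚᵘ p) ℚᵘ.+ ℚ.toℚᵘ (fromℚᵘ q)
    ≈⟨ ℚᵘP.≃-sym (ℚP.toℚᵘ-homo-+ (fromℚᵘ p) (fromℚᵘ q)) ⟩
  ℚ.toℚᵘ (fromℚᵘ p ℚ.+ fromℚᵘ q) ∎)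
  where open ℚᵘP.≃-Reasoning

frac-+ : ∀ a b k → frac (a ℤ.+ b) (suc k) ≡ frac a (suc k) ℚ.+ frac b (suc k)
frac-+ a b k = trans
  (ℚP.fromℚᵘ-cong {mkℚᵘ (a ℤ.+ b) k} {mkℚᵘ a k ℚᵘ.+ mkℚᵘ b k} (*≡* (distrib a b (+ suc k))))
  (fromℚᵘ-homo-+ (mkℚᵘ a k) (mkℚᵘ b k))
  where
  distrib : ∀ a b c → (a ℤ.+ b) ℤ.* (c ℤ.* c) ≡ (a ℤ.* c ℤ.+ b ℤ.* c) ℤ.* c
  distrib = ℤ-Solver.solve-∀

frac-cross : ∀ a b k l → a * suc l ≡ b * suc k → frac (+ a) (suc k) ≡ frac (+ b) (suc l)
frac-cross a b k l eq = ℚP.fromℚᵘ-cong {mkℚᵘ (+ a) k} {mkℚᵘ (+ b) l}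
  (*≡* (trans (sym (ℤP.pos-* a (suc l))) (trans (cong +_ eq) (ℤP.pos-* b (suc k)))))

frac-Σℤ : ∀ {A : Set} (xs : List A) h k → frac (Σℤ xs h) (suc k) ≡ Σℚ xs (λ x → frac (h x) (suc k))
frac-Σℤ xs h k = trans (foldr-fusion (λ z → frac z (suc k)) (+ 0) (λ x y → frac-+ (h x) y k) xs)
                       (foldr-cong (λ _ _ → refl) (ℚP.0/n≡0 (suc k)) xs)

frac-Σℕ : ∀ {A : Set} (xs : List A) h k → frac (+ Σℕ xs h) (suc k) ≡ Σℚ xs (λ x → frac (+ h x) (suc k))
frac-Σℕ xs h k = trans (cong (λ z → frac z (suc k)) (foldr-fusion +_ 0 (λ x y → ℤP.pos-+ (h x) y) xs))
                       (frac-Σℤ xs (+_ ∘ h) k)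

frac-∑ : ∀ n f k → frac (+ ℕ∑.∑ n f) (suc k) ≡ ℚ∑.∑ n (λ i → frac (+ f i) (suc k))
frac-∑ n f k = rangeSum-hom (λ s → frac (+ s) (suc k)) (ℚP.0/n≡0 (suc k))
  (λ x y → trans (cong (λ z → frac z (suc k)) (ℤP.pos-+ x y)) (frac-+ (+ x) (+ y) k)) n f

Σℚ-++ : ∀ {A : Set} (xs ys : List A) f → Σℚ (xs ++ ys) f ≡ Σℚ xs f ℚ.+ Σℚ ys f
Σℚ-++ []       ys f = sym (ℚP.+-identityˡ _)
Σℚ-++ (x ∷ xs) ys f = trans (cong (f x ℚ.+_) (Σℚ-++ xs ys f)) (sym (ℚP.+-assoc (f x) _ _))

Σℚ-range1 : ∀ n f → Σℚ (range1 n) f ≡ ℚ∑.∑ n f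
Σℚ-range1 zero    f = refl
Σℚ-range1 (suc n) f = begin
  Σℚ (map suc (upTo (suc n))) f         ≡⟨ cong (λ l → Σℚ (map suc l) f) (sym (upTo-∷ʳ n)) ⟩
  Σℚ (map suc (upTo n ++ [ n ])) f      ≡⟨ cong (λ l → Σℚ l f) (map-++ suc (upTo n) [ n ]) ⟩
  Σℚ (range1 n ++ [ suc n ]) f          ≡⟨ Σℚ-++ (range1 n) [ suc n ] f ⟩
  Σℚ (range1 n) f ℚ.+ (f (suc n) ℚ.+ 0ℚ) ≡⟨ cong₂ ℚ._+_ (Σℚ-range1 n f) (ℚP.+-identityʳ (f (suc n))) ⟩
  ℚ∑.∑ (suc n) f                        ∎
  where open ≡-Reasoning

Σℚ-filter : ∀ {A : Set} {ℓ} {P : Pred A ℓ} (P? : Decidable P) xs f →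
  Σℚ (filter P? xs) f ≡ Σℚ xs (λ x → if does (P? x) then f x else 0ℚ)
Σℚ-filter P? []       f = refl
Σℚ-filter P? (x ∷ xs) f with does (P? x)
... | true  = cong (f x ℚ.+_) (Σℚ-filter P? xs f)
... | false = trans (Σℚ-filter P? xs f) (sym (ℚP.+-identityˡ _))

ℕ-identity⇒ℤ : ∀ w a m c f → a + 1 + m * c ≡ suc m * f →
  + (w * a) ≡ + w ℤ.* ((+ suc m ℤ.* + f - + m ℤ.* + c) - + 1)
ℕ-identity⇒ℤ w a m c f eq = begin
  + (w * a)
    ≡⟨ ℤP.pos-* w a ⟩
  + w ℤ.* + a
    ≡⟨ cancel (+ w) (+ a) (+ 1) (+ m ℤ.* + c) ⟩
  + w ℤ.* (((+ a ℤ.+ + 1 ℤ.+ + m ℤ.* + c) - + m ℤ.* + c) - + 1)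
    ≡⟨ cong (λ z → + w ℤ.* ((z - + m ℤ.* + c) - + 1)) lifted ⟩
  + w ℤ.* ((+ suc m ℤ.* + f - + m ℤ.* + c) - + 1) ∎
  where
  open ≡-Reasoning
  cancel : ∀ w a o x → w ℤ.* a ≡ w ℤ.* (((a ℤ.+ o ℤ.+ x) - x) - o)
  cancel = ℤ-Solver.solve-∀
  lifted : + a ℤ.+ + 1 ℤ.+ + m ℤ.* + c ≡ + suc m ℤ.* + f
  lifted = begin
    + a ℤ.+ + 1 ℤ.+ + m ℤ.* + c   ≡⟨ cong₂ ℤ._+_ (sym (ℤP.pos-+ a 1)) (sym (ℤP.pos-* m c)) ⟩
    + (a + 1) ℤ.+ + (m * c)       ≡⟨ sym (ℤP.pos-+ (a + 1) (m * c)) ⟩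
    + (a + 1 + m * c)             ≡⟨ cong +_ eq ⟩
    + (suc m * f)                 ≡⟨ ℤP.pos-* (suc m) f ⟩
    + suc m ℤ.* + f               ∎

module Divisors (m n′ : ℕ) where

  open MBonacci m
  open ℚ∑ using (∑; ∑-cong; ∑-ε; ∑-swap; ∑-pad; ∑-multiples)

  n : ℕ
  n = suc n′

  K : ℕ
  K = n / suc m

  binomialTerm : ℕ → ℕ → ℕ
  binomialTerm k d = φ d * ((((n ∸ m * k) div d) ∸ 1) C ((k div d) ∸ 1))

  mbonacciTerm : ℕ → ℤ
  mbonacciTerm d = + φ d ℤ.* ((+ suc m ℤ.* + F m (n div d) - + m ℤ.* + F m ((n div d) ∸ 1)) - + 1)

  contribution : ℕ → ℕ → ℚ
  contribution d k = if does (d ∣? gcd n k) then frac (+ binomialTerm k d) k else 0ℚ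

  row-sum : ∀ k′ → frac (+ Σℕ (divisors (gcd n (suc k′))) (binomialTerm (suc k′))) (suc k′)
                   ≡ ∑ n (λ d → contribution d (suc k′))
  row-sum k′ = begin
    frac (+ Σℕ (divisors G) (binomialTerm k)) k
      ≡⟨ frac-Σℕ (divisors G) (binomialTerm k) k′ ⟩
    Σℚ (divisors G) (λ d → frac (+ binomialTerm k d) k)
      ≡⟨ Σℚ-filter (_∣? G) (range1 G) (λ d → frac (+ binomialTerm k d) k) ⟩
    Σℚ (range1 G) (λ d → contribution d k)
      ≡⟨ Σℚ-range1 G (λ d → contribution d k) ⟩
    ∑ G (λ d → contribution d k)
      ≡⟨ sym (∑-pad G (n ∸ G) (λ d → contribution d k) vanish) ⟩
    ∑ (n ∸ G + G) (λ d → contribution d k)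
      ≡⟨ cong (λ t → ∑ t (λ d → contribution d k)) (m∸n+n≡m (∣⇒≤ (gcd[m,n]∣m n k))) ⟩
    ∑ n (λ d → contribution d k) ∎
    where
    open ≡-Reasoning
    k G : ℕ
    k = suc k′
    G = gcd n k
    vanish : ∀ d → G < d → contribution d k ≡ 0ℚ
    vanish d G<d = if-no (d ∣? G) (λ d∣G → <⇒≱ G<d (∣⇒≤ {{ℕ.≢-nonZero (gcd[m,n]≢0 n k (inj₁ λ ()))}} d∣G))

  module _ (d′ : ℕ) where

    private
      d : ℕ
      d = suc d′

      u : ℕ → ℚ
      u k = frac (+ binomialTerm k d) k

    module _ (d∣n : d ∣ n) where

      private
        N J : ℕ
        N = n / d
        J = N / suc m

      multiple-term : ∀ j → 1 ≤ j → j ≤ J → u (j * d) ≡ frac (+ (φ d * lucasTerm N j)) n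
      multiple-term (suc j) _ j≤J = trans (cong (λ b → frac (+ (φ d * b)) (suc j * d)) binomial≡)
        (frac-cross (φ d * shiftedDiagonal N (suc j)) (φ d * lucasTerm N (suc j)) _ n′ cross)
        where
        binomial≡ : (((n ∸ m * (suc j * d)) / d) ∸ 1) C ((suc j * d) / d ∸ 1) ≡ shiftedDiagonal N (suc j)
        binomial≡ = cong₂ (λ a b → (a ∸ 1) C (b ∸ 1))
          (trans (cong (λ z → (n ∸ z) / d) (sym (*-assoc m (suc j) d))) ([m∸n*o]/o≡m/o∸n n (m * suc j) d))
          (m*n/n≡m (suc j) d)
        mj≤N : m * suc j ≤ N
        mj≤N = ≤-trans (m≤n+m (m * suc j) (suc j)) (≤-trans (*-monoʳ-≤ (suc m) j≤J)
                 (subst (_≤ N) (*-comm J (suc m)) (m/n*n≤m N (suc m))))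
        cross : φ d * shiftedDiagonal N (suc j) * n ≡ φ d * lucasTerm N (suc j) * (suc j * d)
        cross = begin
          φ d * c * n                    ≡⟨ cong (φ d * c *_) (sym (m/n*n≡m d∣n)) ⟩
          φ d * c * (N * d)              ≡⟨ reorder (φ d) c N d ⟩
          φ d * (N * c) * d              ≡⟨ cong (λ z → φ d * z * d) (diagonal-absorption N j mj≤N) ⟩
          φ d * (suc j * t) * d          ≡⟨ sym (reorder (φ d) t (suc j) d) ⟩
          φ d * t * (suc j * d)          ∎
          where
          open ≡-Reasoning
          c = shiftedDiagonal N (suc j)
          t = lucasTerm N (suc j)
          reorder : ∀ a c N d → a * c * (N * d) ≡ a * (N * c) * d
          reorder = ℕ-Solver.solve-∀

      multiples-sum : (d≤K? : Dec (d ≤ K)) →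
        ∑ (K / d) (λ j → u (j * d)) ≡ (if does d≤K? then frac (mbonacciTerm d) n else 0ℚ)
      multiples-sum (no d≰K) = cong (λ t → ∑ t (λ j → u (j * d))) (m<n⇒m/n≡0 (≰⇒> d≰K))
      multiples-sum (yes _)  = begin
        ∑ (K / d) (λ j → u (j * d))
          ≡⟨ cong (λ t → ∑ t (λ j → u (j * d))) K/d≡J ⟩
        ∑ J (λ j → u (j * d))
          ≡⟨ ∑-cong J multiple-term ⟩
        ∑ J (λ j → frac (+ (φ d * lucasTerm N j)) n)
          ≡⟨ sym (frac-∑ J (λ j → φ d * lucasTerm N j) n′) ⟩
        frac (+ ℕ∑.∑ J (λ j → φ d * lucasTerm N j)) n
          ≡⟨ cong (λ z → frac (+ z) n) (∑-*ˡ (φ d) J (lucasTerm N)) ⟩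
        frac (+ (φ d * ℕ∑.∑ J (lucasTerm N))) n
          ≡⟨ cong (λ z → frac z n) (ℕ-identity⇒ℤ (φ d) _ m _ _ (mbonacci-identity N)) ⟩
        frac (mbonacciTerm d) n ∎
        where
        open ≡-Reasoning
        K/d≡J : K / d ≡ J
        K/d≡J = begin
          n / suc m / d            ≡⟨ m/n/o≡m/[n*o] n (suc m) d ⟩
          n / (suc m * d)          ≡⟨ cong (_/ (suc m * d)) (sym (m/n*n≡m d∣n)) ⟩
          N * d / (suc m * d)      ≡⟨ m*n/o*n≡m/o N d (suc m) ⟩
          J                        ∎

    column-sum : (d∣n? : Dec (d ∣ n)) → ∑ K (contribution d) ≡
      (if does d∣n? then (if does (d ≤? K) then frac (mbonacciTerm d) n else 0ℚ) else 0ℚ)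
    column-sum (no d∤n)  = ∑-ε K (λ k _ _ → if-no (d ∣? gcd n k) (λ d∣g → d∤n (∣-trans d∣g (gcd[m,n]∣m n k))))
    column-sum (yes d∣n) = begin
      ∑ K (contribution d)
        ≡⟨ ∑-cong K (λ k _ _ → cong (λ b → if b then u k else 0ℚ) (∣gcd⇔∣ k)) ⟩
      ∑ K (λ k → if does (d ∣? k) then u k else 0ℚ)
        ≡⟨ ∑-multiples d′ u K ⟩
      ∑ (K / d) (λ j → u (j * d))
        ≡⟨ multiples-sum d∣n (d ≤? K) ⟩
      (if does (d ≤? K) then frac (mbonacciTerm d) n else 0ℚ) ∎
      where
      open ≡-Reasoning
      ∣gcd⇔∣ : ∀ k → does (d ∣? gcd n k) ≡ does (d ∣? k)
      ∣gcd⇔∣ k = does-⇔ (mk⇔ (λ d∣g → ∣-trans d∣g (gcd[m,n]∣n n k)) (gcd-greatest d∣n)) (d ∣? gcd n k) (d ∣? k)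

  divisorTerm : ℕ → ℚ
  divisorTerm d = if does (d ∣? n) then (if does (d ≤? K) then frac (mbonacciTerm d) n else 0ℚ) else 0ℚ

lemma5 : (m n : ℕ) → 1 ≤ m → 1 ≤ n →
    Σℚ (range1 (n div suc m))
       (λ k → frac (+ (Σℕ (divisors (gcd n k))
                            (λ d → φ d * ((((n ∸ m * k) div d) ∸ 1) C ((k div d) ∸ 1))))) k)
    ≡ frac (Σℤ (filter (λ d → d ≤? (n div suc m)) (divisors n))
               (λ d → + φ d ℤ.* ((+ suc m ℤ.* + F m (n div d) - + m ℤ.* + F m ((n div d) ∸ 1)) - + 1)))
           n
lemma5 m zero     _ ()
lemma5 m (suc n′) _ _ = begin
  Σℚ (range1 K) (λ k → frac (+ Σℕ (divisors (gcd n k)) (binomialTerm k)) k)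
    ≡⟨ Σℚ-range1 K _ ⟩
  ∑ K (λ k → frac (+ Σℕ (divisors (gcd n k)) (binomialTerm k)) k)
    ≡⟨ ∑-cong K (λ { (suc k′) _ _ → row-sum k′ }) ⟩
  ∑ K (λ k → ∑ n (λ d → contribution d k))
    ≡⟨ ∑-swap K n (λ k d → contribution d k) ⟩
  ∑ n (λ d → ∑ K (contribution d))
    ≡⟨ ∑-cong n (λ { (suc d′) _ _ → column-sum d′ (suc d′ ∣? n) }) ⟩
  ∑ n divisorTerm
    ≡⟨ sym (Σℚ-range1 n divisorTerm) ⟩
  Σℚ (range1 n) divisorTerm
    ≡⟨ sym (Σℚ-filter (_∣? n) (range1 n) _) ⟩
  Σℚ (divisors n) (λ d → if does (d ≤? K) then frac (mbonacciTerm d) n else 0ℚ)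
    ≡⟨ sym (Σℚ-filter (_≤? K) (divisors n) _) ⟩
  Σℚ (filter (_≤? K) (divisors n)) (λ d → frac (mbonacciTerm d) n)
    ≡⟨ sym (frac-Σℤ (filter (_≤? K) (divisors n)) mbonacciTerm n′) ⟩
  frac (Σℤ (filter (_≤? K) (divisors n)) mbonacciTerm) n
    ∎
  where
  open Divisors m n′
  open ℚ∑ using (∑; ∑-cong; ∑-swap)
  open ≡-Reasoning
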